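{- Let $p$ be an odd prime and let $k$ be a non-negative integer. For every $l \in \{0,1,\dots,k\}$, the equation \[ x^2-(p^{2k+2}+1)y^2=-p^{2l+1} \] has no solutions in positive integers $x$ and $y$. -}

module Defs where

{-# OPTIONS --safe #-}
module Submission where

-- Write m = p^(k+1) and n = p^(2l+1), so that n ∣ m² and n < m², and suppose |x² − (m²+1)y²| = n.
-- If p ∣ y then also p ∣ x, and dividing both by p lowers l; so we may assume p ∤ y. Then n divides
-- x² − y² = (x − y)(x + y), and since p is odd and p ∤ y it cannot divide both factors, so n ≤ x + y.
-- Outside the window |x − m y| < y the form is larger than x + y, which is absurd. Inside it,
-- multiplying x + y√(m²+1) by the unit √(m²+1) − m of norm −1 gives a solution with a smaller y,
-- still prime to p: infinite descent.

open import Defs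
open import Data.Nat using (ℕ; _≤_; _<_; _^_; _+_; _*_)
open import Data.Nat.Primality using (Prime)
open import Data.Integer using (ℤ; +_; -_) renaming (_-_ to _-ℤ_; _*_ to _*ℤ_)
open import Relation.Nullary using (¬_)
open import Relation.Binary.PropositionalEquality using (_≡_; _≢_)

open import Data.Nat.Base
  using (zero; suc; _∸_; ∣_-_∣; NonZero; >-nonZero; >-nonZero⁻¹; ≢-nonZero; nonTrivial⇒n>1; z<s)
open import Data.Nat.Properties
open import Data.Nat.Divisibility
open import Data.Nat.Induction using (<-rec)
open import Data.Nat.Primality using (euclidsLemma; prime⇒nonZero; prime⇒nonTrivial)
import Data.Integer as ℤ
import Data.Integer.Properties as ℤ
open import Data.Integer.Divisibility.Signed using (∣ᵤ⇒∣; ∣⇒∣ᵤ; ∣m∣∣m)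
  renaming (_∣_ to _∣ℤ_; ∣m∣n⇒∣m+n to ∣m∣n⇒∣m+nℤ; ∣m⇒∣m*n to ∣m⇒∣m*nℤ)
open import Data.Product using (_×_; _,_; ∃)
open import Data.Sum using (_⊎_; inj₁; inj₂)
open import Function using (_∘_)
open import Relation.Nullary using (yes; no; contradiction)
open import Relation.Binary.PropositionalEquality
  using (refl; sym; trans; cong; cong₂; subst; module ≡-Reasoning)
import Data.Nat.Tactic.RingSolver as ℕ-Ring
import Data.Integer.Tactic.RingSolver as ℤ-Ring

prime^∣*⇒∣ʳ : ∀ {p a b} → Prime p → ¬ p ∣ a → ∀ j → p ^ j ∣ a * b → p ^ j ∣ b
prime^∣*⇒∣ʳ {b = b} _ _ zero _ = 1∣ b
prime^∣*⇒∣ʳ {p} {a} pr p∤a (suc j) p^[j+1]∣ab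
  with euclidsLemma a _ pr (m*n∣⇒m∣ p (p ^ j) p^[j+1]∣ab)
... | inj₁ p∣a = contradiction p∣a p∤a
... | inj₂ (divides q refl) = subst (p * p ^ j ∣_) (*-comm p q) (*-monoʳ-∣ p p^j∣q)
  where
  instance _ = prime⇒nonZero pr
  a[qp]≡p[aq] : a * (q * p) ≡ p * (a * q)
  a[qp]≡p[aq] = trans (sym (*-assoc a q p)) (*-comm (a * q) p)
  p^j∣q : p ^ j ∣ q
  p^j∣q = prime^∣*⇒∣ʳ pr p∤a j (*-cancelˡ-∣ p (subst (p * p ^ j ∣_) a[qp]≡p[aq] p^[j+1]∣ab))

prime^∣*⇒∣⊎∣ : ∀ {p a b} → Prime p → ¬ (p ∣ a × p ∣ b) →
               ∀ j → p ^ j ∣ a * b → p ^ j ∣ a ⊎ p ^ j ∣ b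
prime^∣*⇒∣⊎∣ {p} {a} {b} pr p∤ab j p^j∣ab with p ∣? a
... | yes p∣a = inj₁ (prime^∣*⇒∣ʳ pr (λ p∣b → p∤ab (p∣a , p∣b)) j
                       (subst (p ^ j ∣_) (*-comm a b) p^j∣ab))
... | no p∤a  = inj₂ (prime^∣*⇒∣ʳ pr p∤a j p^j∣ab)

^-monoʳ-∣ : ∀ m {a b} → a ≤ b → m ^ a ∣ m ^ b
^-monoʳ-∣ m {a} a≤b with m≤n⇒∃[o]m+o≡n a≤b
... | r , refl = divides (m ^ r) (trans (^-distribˡ-+-* m a r) (*-comm (m ^ a) (m ^ r)))

m∣m^n : ∀ m {n} → 0 < n → m ∣ m ^ n
m∣m^n m {suc n} _ = m∣m*n (m ^ n)

odd-prime⇒∤2 : ∀ {p} → Prime p → p ≢ 2 → ¬ p ∣ 2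
odd-prime⇒∤2 pr p≢2 p∣2 = p≢2 (≤-antisym (∣⇒≤ p∣2) (nonTrivial⇒n>1 _ {{prime⇒nonTrivial pr}}))

prime∣n*n⇒∣n : ∀ {p n} → Prime p → p ∣ n * n → p ∣ n
prime∣n*n⇒∣n pr p∣nn with euclidsLemma _ _ pr p∣nn
... | inj₁ p∣n = p∣n
... | inj₂ p∣n = p∣n

∣⇒≡0⊎≤ : ∀ {d n} → d ∣ n → n ≡ 0 ⊎ d ≤ n
∣⇒≡0⊎≤ {n = zero}  _   = inj₁ refl
∣⇒≡0⊎≤ {n = suc _} d∣n = inj₂ (∣⇒≤ d∣n)

∤⇒>0 : ∀ {d n} → ¬ d ∣ n → 0 < n
∤⇒>0 {n = zero}  d∤0 = contradiction (_ ∣0) d∤0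
∤⇒>0 {n = suc _} _   = z<s

∣∣m-n∣∣n⇒∣m : ∀ {d} m n → d ∣ ∣ m - n ∣ → d ∣ n → d ∣ m
∣∣m-n∣∣n⇒∣m {d} m n d∣∣m-n∣ d∣n with ≤-total n m
... | inj₁ n≤m = ∣m∸n∣n⇒∣m d n≤m (subst (d ∣_) (m≤n⇒∣n-m∣≡n∸m n≤m) d∣∣m-n∣) d∣n
... | inj₂ m≤n = ∣m+n∣m⇒∣n (subst (d ∣_) (trans (sym (m+[n∸m]≡n m≤n)) (+-comm m (n ∸ m))) d∣n)
                           (subst (d ∣_) (m≤n⇒∣m-n∣≡n∸m m≤n) d∣∣m-n∣)

∣∣m-n∣∣m⇒∣n : ∀ {d} m n → d ∣ ∣ m - n ∣ → d ∣ m → d ∣ n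
∣∣m-n∣∣m⇒∣n {d} m n d∣∣m-n∣ = ∣∣m-n∣∣n⇒∣m n m (subst (d ∣_) (∣-∣-comm m n) d∣∣m-n∣)

∣∣m-n∣∣m+n⇒∣2n : ∀ {d} m n → d ∣ ∣ m - n ∣ → d ∣ m + n → d ∣ 2 * n
∣∣m-n∣∣m+n⇒∣2n {d} m n d∣∣m-n∣ d∣m+n with ≤-total n m
... | inj₁ n≤m with m≤n⇒∃[o]m+o≡n n≤m
...   | e , refl = ∣m+n∣m⇒∣n (subst (d ∣_) (regroup n e) d∣m+n) d∣e
  where
  regroup : ∀ n e → (n + e) + n ≡ e + 2 * n
  regroup = ℕ-Ring.solve-∀
  d∣e : d ∣ e
  d∣e = subst (d ∣_) (trans (∣-∣-comm (n + e) n) (∣m-m+n∣≡n n e)) d∣∣m-n∣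
∣∣m-n∣∣m+n⇒∣2n {d} m n d∣∣m-n∣ d∣m+n | inj₂ m≤n with m≤n⇒∃[o]m+o≡n m≤n
...   | e , refl = subst (d ∣_) (regroup m e) (∣m∣n⇒∣m+n d∣m+n (subst (d ∣_) (∣m-m+n∣≡n m e) d∣∣m-n∣))
  where
  regroup : ∀ m e → (m + (m + e)) + e ≡ 2 * (m + e)
  regroup = ℕ-Ring.solve-∀

∣m-n∣≤m+n : ∀ m n → ∣ m - n ∣ ≤ m + n
∣m-n∣≤m+n m n = ≤-trans (∣m-n∣≤m⊔n m n) (m⊔n≤m+n m n)

∣m-n∣<o : ∀ m n {o} → .{{NonZero o}} → m < n + o → n < m + o → ∣ m - n ∣ < o
∣m-n∣<o m n {o} m<n+o n<m+o with ∣m-n∣≡[m∸n]∨[n∸m] m n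
... | inj₁ ∣m-n∣≡m∸n = subst (_< o) (sym ∣m-n∣≡m∸n) (m<n+o⇒m∸n<o m n m<n+o)
... | inj₂ ∣m-n∣≡n∸m = subst (_< o) (sym ∣m-n∣≡n∸m) (m<n+o⇒m∸n<o n m n<m+o)

pell : ℤ → ℤ → ℤ → ℤ
pell m x y = x *ℤ x -ℤ (m *ℤ m ℤ.+ ℤ.1ℤ) *ℤ (y *ℤ y)

-- The descent flips the sign of x² − (m²+1)y², so only its absolute value is invariant.
pellNorm : ℕ → ℕ → ℕ → ℕ
pellNorm m x y = ∣ x * x - (m * m + 1) * (y * y) ∣

-- (x + y√(m²+1)) (√(m²+1) − m) = ((m²+1)y − m x) + (x − m y)√(m²+1)
pell-reflect : ∀ m x y → pell m ((m *ℤ m ℤ.+ ℤ.1ℤ) *ℤ y -ℤ m *ℤ x) (x -ℤ m *ℤ y) ≡ - pell m x y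
pell-reflect = identity
  where
  identity : ∀ m x y →
    let x′ = (m *ℤ m ℤ.+ ℤ.1ℤ) *ℤ y -ℤ m *ℤ x
        y′ = x -ℤ m *ℤ y
    in x′ *ℤ x′ -ℤ (m *ℤ m ℤ.+ ℤ.1ℤ) *ℤ (y′ *ℤ y′) ≡ - (x *ℤ x -ℤ (m *ℤ m ℤ.+ ℤ.1ℤ) *ℤ (y *ℤ y))
  identity = ℤ-Ring.solve-∀

∣+m-+n∣≡∣m-n∣ : ∀ m n → ℤ.∣ + m -ℤ + n ∣ ≡ ∣ m - n ∣
∣+m-+n∣≡∣m-n∣ m n with ≤-total n m
... | inj₁ n≤m = begin
  ℤ.∣ + m -ℤ + n ∣ ≡⟨ cong ℤ.∣_∣ (ℤ.m-n≡m⊖n m n) ⟩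
  ℤ.∣ m ℤ.⊖ n ∣    ≡⟨ cong ℤ.∣_∣ (ℤ.⊖-≥ n≤m) ⟩
  m ∸ n            ≡⟨ m≤n⇒∣n-m∣≡n∸m n≤m ⟨
  ∣ m - n ∣        ∎
  where open ≡-Reasoning
... | inj₂ m≤n = begin
  ℤ.∣ + m -ℤ + n ∣ ≡⟨ cong ℤ.∣_∣ (ℤ.m-n≡m⊖n m n) ⟩
  ℤ.∣ m ℤ.⊖ n ∣    ≡⟨ ℤ.∣⊖∣-≤ m≤n ⟩
  n ∸ m            ≡⟨ m≤n⇒∣m-n∣≡n∸m m≤n ⟨
  ∣ m - n ∣        ∎
  where open ≡-Reasoning

+[m*m+1]≡ : ∀ m → + (m * m + 1) ≡ + m *ℤ + m ℤ.+ ℤ.1ℤ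
+[m*m+1]≡ m = trans (ℤ.pos-+ (m * m) 1) (cong (ℤ._+ ℤ.1ℤ) (ℤ.pos-* m m))

pellNorm≡∣pell∣ : ∀ m x y → pellNorm m x y ≡ ℤ.∣ pell (+ m) (+ x) (+ y) ∣
pellNorm≡∣pell∣ m x y = sym (trans (cong ℤ.∣_∣ (cong₂ _-ℤ_ (sym (ℤ.pos-* x x)) coefficient))
                                   (∣+m-+n∣≡∣m-n∣ (x * x) ((m * m + 1) * (y * y))))
  where
  coefficient : (+ m *ℤ + m ℤ.+ ℤ.1ℤ) *ℤ (+ y *ℤ + y) ≡ + ((m * m + 1) * (y * y))
  coefficient = sym (trans (ℤ.pos-* (m * m + 1) (y * y)) (cong₂ _*ℤ_ (+[m*m+1]≡ m) (ℤ.pos-* y y)))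

+∣i∣*+∣i∣≡i*i : ∀ i → + ℤ.∣ i ∣ *ℤ + ℤ.∣ i ∣ ≡ i *ℤ i
+∣i∣*+∣i∣≡i*i (+ _)      = refl
+∣i∣*+∣i∣≡i*i ℤ.-[1+ _ ] = refl

pellNorm-reflect : ∀ m x y → pellNorm m ∣ (m * m + 1) * y - m * x ∣ ∣ x - m * y ∣ ≡ pellNorm m x y
pellNorm-reflect m x y = begin
  pellNorm m ∣ (m * m + 1) * y - m * x ∣ ∣ x - m * y ∣ ≡⟨ cong₂ (pellNorm m) ∣x′∣≡ ∣y′∣≡ ⟨
  pellNorm m ℤ.∣ x′ ∣ ℤ.∣ y′ ∣                        ≡⟨ pellNorm≡∣pell∣ m ℤ.∣ x′ ∣ ℤ.∣ y′ ∣ ⟩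
  ℤ.∣ pell M (+ ℤ.∣ x′ ∣) (+ ℤ.∣ y′ ∣) ∣               ≡⟨ cong ℤ.∣_∣ (cong₂ (λ s t → s -ℤ (M *ℤ M ℤ.+ ℤ.1ℤ) *ℤ t)
                                                            (+∣i∣*+∣i∣≡i*i x′) (+∣i∣*+∣i∣≡i*i y′)) ⟩
  ℤ.∣ pell M x′ y′ ∣                                  ≡⟨ cong ℤ.∣_∣ (pell-reflect M (+ x) (+ y)) ⟩
  ℤ.∣ - pell M (+ x) (+ y) ∣                          ≡⟨ ℤ.∣-i∣≡∣i∣ (pell M (+ x) (+ y)) ⟩
  ℤ.∣ pell M (+ x) (+ y) ∣                            ≡⟨ pellNorm≡∣pell∣ m x y ⟨
  pellNorm m x y                                      ∎
  where
  open ≡-Reasoning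
  M = + m
  x′ = (M *ℤ M ℤ.+ ℤ.1ℤ) *ℤ + y -ℤ M *ℤ + x
  y′ = + x -ℤ M *ℤ + y
  ∣x′∣≡ : ℤ.∣ x′ ∣ ≡ ∣ (m * m + 1) * y - m * x ∣
  ∣x′∣≡ = trans (cong ℤ.∣_∣ (cong₂ _-ℤ_ D*y≡ (sym (ℤ.pos-* m x)))) (∣+m-+n∣≡∣m-n∣ ((m * m + 1) * y) (m * x))
    where
    D*y≡ : (M *ℤ M ℤ.+ ℤ.1ℤ) *ℤ + y ≡ + ((m * m + 1) * y)
    D*y≡ = sym (trans (ℤ.pos-* (m * m + 1) y) (cong (_*ℤ + y) (+[m*m+1]≡ m)))
  ∣y′∣≡ : ℤ.∣ y′ ∣ ≡ ∣ x - m * y ∣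
  ∣y′∣≡ = trans (cong (λ t → ℤ.∣ + x -ℤ t ∣) (sym (ℤ.pos-* m y))) (∣+m-+n∣≡∣m-n∣ x (m * y))

pellNorm-scale : ∀ m x y c → pellNorm m (x * c) (y * c) ≡ c * c * pellNorm m x y
pellNorm-scale m x y c = trans (cong₂ ∣_-_∣ (squares x c) (squares′ (m * m + 1) y c))
                              (sym (*-distribˡ-∣-∣ (c * c) (x * x) ((m * m + 1) * (y * y))))
  where
  squares : ∀ x c → x * c * (x * c) ≡ c * c * (x * x)
  squares = ℕ-Ring.solve-∀
  squares′ : ∀ d y c → d * (y * c * (y * c)) ≡ c * c * (d * (y * y))
  squares′ = ℕ-Ring.solve-∀

pellNorm-diagonal : ∀ m y → pellNorm m y y ≡ m * m * (y * y)
pellNorm-diagonal m y = trans (cong (λ t → ∣ y * y - t ∣) (expand m y))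
                              (∣m-m+n∣≡n (y * y) (m * m * (y * y)))
  where
  expand : ∀ m y → (m * m + 1) * (y * y) ≡ y * y + m * m * (y * y)
  expand = ℕ-Ring.solve-∀

∣pellNorm∧∣y⇒∣x : ∀ {p m x y} → Prime p → p ∣ pellNorm m x y → p ∣ y → p ∣ x
∣pellNorm∧∣y⇒∣x {m = m} {x} {y} pr p∣N p∣y =
  prime∣n*n⇒∣n pr (∣∣m-n∣∣n⇒∣m (x * x) _ p∣N (∣n⇒∣m*n (m * m + 1) (∣m⇒∣m*n y p∣y)))

∣pellNorm∧∣m∧∣x⇒∣y : ∀ {p m x y} → Prime p → p ∣ pellNorm m x y → p ∣ m → p ∣ x → p ∣ y
∣pellNorm∧∣m∧∣x⇒∣y {p} {m} {x} {y} pr p∣N p∣m p∣x =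
  prime∣n*n⇒∣n pr (∣m+n∣m⇒∣n p∣m²y²+y² p∣m²y²)
  where
  expand : ∀ m y → (m * m + 1) * (y * y) ≡ m * m * (y * y) + y * y
  expand = ℕ-Ring.solve-∀
  p∣m²y²+y² : p ∣ m * m * (y * y) + y * y
  p∣m²y²+y² = subst (p ∣_) (expand m y) (∣∣m-n∣∣m⇒∣n (x * x) _ p∣N (∣m⇒∣m*n x p∣x))
  p∣m²y² : p ∣ m * m * (y * y)
  p∣m²y² = ∣m⇒∣m*n (y * y) (∣m⇒∣m*n m p∣m)

pellNorm-above : ∀ m y f →
  pellNorm m (m * y + y + f) y ≡ 2 * m * (y * y) + (m * y + y + f + (m * y + y)) * f
pellNorm-above m y f = begin
  ∣ x * x - Dy² ∣          ≡⟨ cong (λ t → ∣ t - Dy² ∣) (expand m y f) ⟩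
  ∣ Dy² + excess - Dy² ∣   ≡⟨ ∣-∣-comm (Dy² + excess) Dy² ⟩
  ∣ Dy² - Dy² + excess ∣   ≡⟨ ∣m-m+n∣≡n Dy² excess ⟩
  excess                   ∎
  where
  open ≡-Reasoning
  x = m * y + y + f
  Dy² = (m * m + 1) * (y * y)
  excess = 2 * m * (y * y) + (x + (m * y + y)) * f
  expand : ∀ m y f → (m * y + y + f) * (m * y + y + f)
                   ≡ (m * m + 1) * (y * y) + (2 * m * (y * y) + (m * y + y + f + (m * y + y)) * f)
  expand = ℕ-Ring.solve-∀

pellNorm-below : ∀ {m x y} f → x + y + f ≡ m * y →
  pellNorm m x y ≡ y * y + (y + f) * (x + y + (x + f))
pellNorm-below {m} {x} {y} f x+y+f≡my = begin
  ∣ x * x - (m * m + 1) * (y * y) ∣ ≡⟨ cong (λ t → ∣ x * x - t ∣) D≡ ⟩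
  ∣ x * x - x * x + excess ∣         ≡⟨ ∣m-m+n∣≡n (x * x) excess ⟩
  excess                            ∎
  where
  open ≡-Reasoning
  excess = y * y + (y + f) * (x + y + (x + f))
  split : ∀ m y → (m * m + 1) * (y * y) ≡ m * y * (m * y) + y * y
  split = ℕ-Ring.solve-∀
  expand : ∀ x y f → (x + y + f) * (x + y + f) + y * y ≡ x * x + (y * y + (y + f) * (x + y + (x + f)))
  expand = ℕ-Ring.solve-∀
  D≡ : (m * m + 1) * (y * y) ≡ x * x + excess
  D≡ = begin
    (m * m + 1) * (y * y)                 ≡⟨ split m y ⟩
    m * y * (m * y) + y * y               ≡⟨ cong (λ t → t * t + y * y) x+y+f≡my ⟨
    (x + y + f) * (x + y + f) + y * y     ≡⟨ expand x y f ⟩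
    x * x + excess                        ∎

outer⇒<pellNorm : ∀ {m x y} → 3 ≤ m → .{{NonZero y}} →
  m * y + y ≤ x ⊎ x + y ≤ m * y → x + y < pellNorm m x y
outer⇒<pellNorm {m} {x} {y} 3≤m (inj₁ my+y≤x) with m≤n⇒∃[o]m+o≡n my+y≤x
... | f , refl = begin-strict
  m * y + y + f + y                   ≡⟨ regroup m y f ⟩
  m * y + 2 * y + f                   <⟨ +-mono-<-≤ my+2y<2my² f≤[x+my+y]f ⟩
  2 * m * (y * y) + (x + (m * y + y)) * f ≡⟨ pellNorm-above m y f ⟨
  pellNorm m x y                      ∎
  where
  open ≤-Reasoning
  regroup : ∀ m y f → m * y + y + f + y ≡ m * y + 2 * y + f
  regroup = ℕ-Ring.solve-∀
  double : ∀ m y → m * y + m * y ≡ 2 * m * y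
  double = ℕ-Ring.solve-∀
  my+2y<2my² : m * y + 2 * y < 2 * m * (y * y)
  my+2y<2my² = begin-strict
    m * y + 2 * y   <⟨ +-monoʳ-< (m * y) (*-monoˡ-< y 3≤m) ⟩
    m * y + m * y   ≡⟨ double m y ⟩
    2 * m * y       ≤⟨ *-monoʳ-≤ (2 * m) (m≤m*n y y) ⟩
    2 * m * (y * y) ∎
  f≤[x+my+y]f : f ≤ (x + (m * y + y)) * f
  f≤[x+my+y]f = ≤-trans (m≤n*m f y) (*-monoˡ-≤ f (≤-trans (m≤n+m y (m * y)) (m≤n+m (m * y + y) x)))
outer⇒<pellNorm {m} {x} {y} _ (inj₂ x+y≤my) with m≤n⇒∃[o]m+o≡n x+y≤my
... | f , x+y+f≡my = begin-strict
  x + y                            ≤⟨ m≤m+n (x + y) (x + f) ⟩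
  x + y + (x + f)                  ≤⟨ m≤n*m _ y ⟩
  y * (x + y + (x + f))            ≤⟨ *-monoˡ-≤ _ (m≤m+n y f) ⟩
  (y + f) * (x + y + (x + f))      <⟨ m<n+m _ (>-nonZero⁻¹ (y * y) {{m*n≢0 y y}}) ⟩
  y * y + (y + f) * (x + y + (x + f)) ≡⟨ pellNorm-below {m} f x+y+f≡my ⟨
  pellNorm m x y                   ∎
  where open ≤-Reasoning

outer⊎inner : ∀ m x y → (m * y + y ≤ x ⊎ x + y ≤ m * y) ⊎ (x < m * y + y × m * y < x + y)
outer⊎inner m x y with m * y + y ≤? x | x + y ≤? m * y
... | yes my+y≤x | _          = inj₁ (inj₁ my+y≤x)
... | no _       | yes x+y≤my = inj₁ (inj₂ x+y≤my)
... | no my+y≰x  | no x+y≰my  = inj₂ (≰⇒> my+y≰x , ≰⇒> x+y≰my)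

module CoprimeDescent {p m j : ℕ} (p-prime : Prime p) (p≢2 : p ≢ 2) (p∣m : p ∣ m)
                      (0<j : 0 < j) (n∣m² : p ^ j ∣ m * m) (n<m² : p ^ j < m * m) where

  private
    n = p ^ j

  3≤m : 3 ≤ m
  3≤m = ≤-trans 3≤p (∣⇒≤ {{≢-nonZero m≢0}} p∣m)
    where
    3≤p : 3 ≤ p
    3≤p = ≤∧≢⇒< (nonTrivial⇒n>1 p {{prime⇒nonTrivial p-prime}}) (p≢2 ∘ sym)
    m≢0 : m ≢ 0
    m≢0 refl = n≮0 n<m²

  p∤y⇒p∤x : ∀ {x y} → ¬ p ∣ y → pellNorm m x y ≡ n → ¬ p ∣ x
  p∤y⇒p∤x p∤y N≡n p∣x =
    p∤y (∣pellNorm∧∣m∧∣x⇒∣y p-prime (subst (p ∣_) (sym N≡n) (m∣m^n p 0<j)) p∣m p∣x)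

  n∣∣x-y∣[x+y] : ∀ {x y} → pellNorm m x y ≡ n → n ∣ ∣ x - y ∣ * (x + y)
  n∣∣x-y∣[x+y] {x} {y} N≡n = subst (n ∣_) ∣[x-y][x+y]∣≡ (∣⇒∣ᵤ n∣[x-y][x+y])
    where
    M = + m
    difference-of-squares : ∀ M x y →
      (x -ℤ y) *ℤ (x ℤ.+ y) ≡ (x *ℤ x -ℤ (M *ℤ M ℤ.+ ℤ.1ℤ) *ℤ (y *ℤ y)) ℤ.+ M *ℤ M *ℤ (y *ℤ y)
    difference-of-squares = ℤ-Ring.solve-∀
    n∣pell : + n ∣ℤ pell M (+ x) (+ y)
    n∣pell = subst (λ t → + t ∣ℤ pell M (+ x) (+ y)) (trans (sym (pellNorm≡∣pell∣ m x y)) N≡n) ∣m∣∣m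
    n∣M²y² : + n ∣ℤ M *ℤ M *ℤ (+ y *ℤ + y)
    n∣M²y² = ∣m⇒∣m*nℤ (+ y *ℤ + y) (subst (+ n ∣ℤ_) (ℤ.pos-* m m) (∣ᵤ⇒∣ n∣m²))
    n∣[x-y][x+y] : + n ∣ℤ (+ x -ℤ + y) *ℤ (+ x ℤ.+ + y)
    n∣[x-y][x+y] = subst (+ n ∣ℤ_) (sym (difference-of-squares M (+ x) (+ y)))
                         (∣m∣n⇒∣m+nℤ n∣pell n∣M²y²)
    ∣[x-y][x+y]∣≡ : ℤ.∣ (+ x -ℤ + y) *ℤ (+ x ℤ.+ + y) ∣ ≡ ∣ x - y ∣ * (x + y)
    ∣[x-y][x+y]∣≡ = trans (ℤ.abs-* (+ x -ℤ + y) (+ x ℤ.+ + y))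
                          (cong₂ _*_ (∣+m-+n∣≡∣m-n∣ x y) (cong ℤ.∣_∣ (sym (ℤ.pos-+ x y))))

  p∤∣x-y∣∧p∤x+y : ∀ {x y} → ¬ p ∣ y → ¬ (p ∣ ∣ x - y ∣ × p ∣ x + y)
  p∤∣x-y∣∧p∤x+y {x} {y} p∤y (p∣∣x-y∣ , p∣x+y)
    with euclidsLemma 2 y p-prime (∣∣m-n∣∣m+n⇒∣2n x y p∣∣x-y∣ p∣x+y)
  ... | inj₁ p∣2 = odd-prime⇒∤2 p-prime p≢2 p∣2
  ... | inj₂ p∣y = p∤y p∣y

  n≤x+y : ∀ {x y} → ¬ p ∣ y → pellNorm m x y ≡ n → n ≤ x + y
  n≤x+y {x} {y} p∤y N≡n with prime^∣*⇒∣⊎∣ p-prime (p∤∣x-y∣∧p∤x+y p∤y) j (n∣∣x-y∣[x+y] {x} N≡n)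
  ... | inj₂ n∣x+y = ∣⇒≤ {{>-nonZero (≤-trans (∤⇒>0 p∤y) (m≤n+m y x))}} n∣x+y
  ... | inj₁ n∣∣x-y∣ with ∣⇒≡0⊎≤ n∣∣x-y∣
  ...   | inj₂ n≤∣x-y∣ = ≤-trans n≤∣x-y∣ (∣m-n∣≤m+n x y)
  ...   | inj₁ ∣x-y∣≡0 with ∣m-n∣≡0⇒m≡n {x} {y} ∣x-y∣≡0
  ...     | refl = contradiction (≤-trans (m≤m*n (m * m) (x * x)) (≤-reflexive diagonal)) (<⇒≱ n<m²)
    where
    instance
      _ = >-nonZero (∤⇒>0 p∤y)
      _ = m*n≢0 x x
    diagonal : m * m * (x * x) ≡ n
    diagonal = trans (sym (pellNorm-diagonal m x)) N≡n

  descend : ∀ {x y} → x < m * y + y × m * y < x + y → ¬ p ∣ y → pellNorm m x y ≡ n →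
            ∃ λ x′ → ∃ λ y′ → y′ < y × ¬ p ∣ y′ × pellNorm m x′ y′ ≡ n
  descend {x} {y} (x<my+y , my<x+y) p∤y N≡n =
    ∣ (m * m + 1) * y - m * x ∣ , ∣ x - m * y ∣
      , ∣m-n∣<o x (m * y) {{>-nonZero (∤⇒>0 p∤y)}} x<my+y my<x+y
      , p∤∣x-my∣
      , trans (pellNorm-reflect m x y) N≡n
    where
    p∤∣x-my∣ : ¬ p ∣ ∣ x - m * y ∣
    p∤∣x-my∣ p∣∣x-my∣ = p∤y⇒p∤x p∤y N≡n (∣∣m-n∣∣n⇒∣m x (m * y) p∣∣x-my∣ (∣m⇒∣m*n y p∣m))

  no-coprime-solution : ∀ y x → ¬ p ∣ y → pellNorm m x y ≢ n
  no-coprime-solution = <-rec _ step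
    where
    step : ∀ y → (∀ {y′} → y′ < y → ∀ x → ¬ p ∣ y′ → pellNorm m x y′ ≢ n) →
           ∀ x → ¬ p ∣ y → pellNorm m x y ≢ n
    step y smaller x p∤y N≡n with outer⊎inner m x y
    ... | inj₁ outer = <⇒≱ (subst (x + y <_) N≡n (outer⇒<pellNorm {m} 3≤m {{y≢0}} outer)) (n≤x+y p∤y N≡n)
      where y≢0 = >-nonZero (∤⇒>0 p∤y)
    ... | inj₂ inner with descend inner p∤y N≡n
    ...   | x′ , y′ , y′<y , p∤y′ , N′≡n = smaller y′<y x′ p∤y′ N′≡n

module OddPowers {p : ℕ} (k : ℕ) (p-prime : Prime p) (p≢2 : p ≢ 2) where

  private
    m = p ^ suc k
    instance
      _ = prime⇒nonZero p-prime
      _ = prime⇒nonTrivial p-prime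

  m*m≡p^[2k+2] : m * m ≡ p ^ (2 * k + 2)
  m*m≡p^[2k+2] = trans (sym (^-distribˡ-+-* p (suc k) (suc k))) (cong (p ^_) (exponent k))
    where
    exponent : ∀ k → suc k + suc k ≡ 2 * k + 2
    exponent = ℕ-Ring.solve-∀

  0<2l+1 : ∀ l → 0 < 2 * l + 1
  0<2l+1 l = m≤n+m 1 (2 * l)

  no-solution : ∀ l → l ≤ k → ∀ x y → pellNorm m x y ≢ p ^ (2 * l + 1)
  no-solution l l≤k x y N≡n with p ∣? y
  ... | no p∤y = CoprimeDescent.no-coprime-solution
                   p-prime p≢2 (m∣m*n (p ^ k)) (0<2l+1 l) n∣m² n<m² y x p∤y N≡n
    where
    2l+1<2k+2 : 2 * l + 1 < 2 * k + 2
    2l+1<2k+2 = +-mono-≤-< (*-monoʳ-≤ 2 l≤k) (n<1+n 1)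
    n∣m² : p ^ (2 * l + 1) ∣ m * m
    n∣m² = subst (p ^ (2 * l + 1) ∣_) (sym m*m≡p^[2k+2]) (^-monoʳ-∣ p (<⇒≤ 2l+1<2k+2))
    n<m² : p ^ (2 * l + 1) < m * m
    n<m² = subst (p ^ (2 * l + 1) <_) (sym m*m≡p^[2k+2]) (^-monoʳ-< p (nonTrivial⇒n>1 p) 2l+1<2k+2)
  ... | yes (divides y′ refl)
    with ∣pellNorm∧∣y⇒∣x {m = m} {x} p-prime (subst (p ∣_) (sym N≡n) (m∣m^n p (0<2l+1 l))) (n∣m*n y′)
  ...   | divides x′ refl = lower l l≤k (trans (sym (*-assoc p p N)) (trans (sym (pellNorm-scale m x′ y′ p)) N≡n))
    where
    N = pellNorm m x′ y′
    exponent : ∀ l → 2 * suc l + 1 ≡ 2 + (2 * l + 1)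
    exponent = ℕ-Ring.solve-∀
    lower : ∀ l → l ≤ k → p * (p * N) ≢ p ^ (2 * l + 1)
    lower zero    _     p²N≡p       = <⇒≢ (nonTrivial⇒n>1 p) (sym (m*n≡1⇒m≡1 p N (*-cancelˡ-≡ _ _ p p²N≡p)))
    lower (suc l) l+1≤k p²N≡p^[2l+3] = no-solution l (≤-trans (n≤1+n l) l+1≤k) x′ y′
      (*-cancelˡ-≡ _ _ p (*-cancelˡ-≡ _ _ p (trans p²N≡p^[2l+3] (cong (p ^_) (exponent l)))))

theorem2 : (p k l : ℕ) → Prime p → p ≢ 2 → l ≤ k →
    (x y : ℕ) → 0 < x → 0 < y →
    ¬ ((+ x) *ℤ (+ x) -ℤ (+ (p ^ (2 * k + 2) + 1)) *ℤ ((+ y) *ℤ (+ y)) ≡ - (+ (p ^ (2 * l + 1))))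
theorem2 p k l p-prime p≢2 l≤k x y _ _ equation = no-solution l l≤k x y (begin
  pellNorm m x y                ≡⟨ pellNorm≡∣pell∣ m x y ⟩
  ℤ.∣ pell (+ m) (+ x) (+ y) ∣  ≡⟨ cong ℤ.∣_∣ (trans (cong (λ c → + x *ℤ + x -ℤ c *ℤ (+ y *ℤ + y)) coefficient)
                                                     equation) ⟩
  ℤ.∣ - + (p ^ (2 * l + 1)) ∣   ≡⟨ ℤ.∣-i∣≡∣i∣ (+ (p ^ (2 * l + 1))) ⟩
  p ^ (2 * l + 1)               ∎)
  where
  open ≡-Reasoning
  open OddPowers k p-prime p≢2
  m = p ^ suc k
  coefficient : + m *ℤ + m ℤ.+ ℤ.1ℤ ≡ + (p ^ (2 * k + 2) + 1)
  coefficient = trans (sym (+[m*m+1]≡ m)) (cong (λ t → + (t + 1)) m*m≡p^[2k+2])
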